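{- For every $n\geq 4$, the Fibonacci cube $\Gamma_n$ is isomorphic to an induced subgraph of its cube-complement $\overline{\Gamma}_n$.
   Context: The hypercube $Q_n$ has vertex set the binary strings of length $n$, adjacency meaning differing in exactly one position. $\Gamma_n$ is the subgraph of $Q_n$ induced by the binary strings of length $n$ with no two consecutive 1's, and $\overline{\Gamma}_n$ is the subgraph of $Q_n$ induced by the binary strings of length $n$ containing $11$ as a substring. -}

module Defs where

open import Data.Bool using (Bool; true; false)
open import Data.Nat using (ℕ; zero; suc)
open import Data.Vec using (Vec; []; _∷_)
open import Data.Product using (Σ; proj₁)
open import Data.Empty using (⊥)
open import Relation.Nullary using (¬_)
open import Relation.Binary.PropositionalEquality using (_≡_)
open import Function.Bundles using (_⇔_)

data Adj : {n : ℕ} → Vec Bool n → Vec Bool n → Set where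
  here  : ∀ {n} {a b : Bool} {u : Vec Bool n} → ¬ (a ≡ b) → Adj (a ∷ u) (b ∷ u)
  there : ∀ {n} {a : Bool} {u v : Vec Bool n} → Adj u v → Adj (a ∷ u) (a ∷ v)

data Has11 : {n : ℕ} → Vec Bool n → Set where
  here  : ∀ {n} {u : Vec Bool n} → Has11 (true ∷ true ∷ u)
  there : ∀ {n} {a : Bool} {u : Vec Bool n} → Has11 u → Has11 (a ∷ u)

Fib : {n : ℕ} → Vec Bool n → Set
Fib u = ¬ Has11 u

ΓV : ℕ → Set
ΓV n = Σ (Vec Bool n) Fib

ΓbarV : ℕ → Set
ΓbarV n = Σ (Vec Bool n) Has11

ΓAdj : {n : ℕ} → ΓV n → ΓV n → Set
ΓAdj u v = Adj (proj₁ u) (proj₁ v)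

ΓbarAdj : {n : ℕ} → ΓbarV n → ΓbarV n → Set
ΓbarAdj u v = Adj (proj₁ u) (proj₁ v)

record InducedEmbedding (n : ℕ) : Set where
  field
    f       : ΓV n → ΓbarV n
    inj     : ∀ u v → proj₁ (f u) ≡ proj₁ (f v) → proj₁ u ≡ proj₁ v
    adj⇔    : ∀ u v → ΓAdj u v ⇔ ΓbarAdj (f u) (f v)

module Submission where

-- The map σ that complements the first four bits of a string and swaps the
-- second and third of them is an involutive automorphism of Q_n, so it is an
-- induced embedding of Q_n into itself.  It sends every Fibonacci string to a
-- string containing 11: writing the first four bits abcd, if c = 0 then
-- either a = 0 and σ starts with 11, or a = 1, b = 0 and 11 sits at
-- positions 2–3; if c = 1 then b = d = 0 and 11 sits at positions 3–4.

open import Defs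
open import Data.Nat using (ℕ; suc; _≥_; s≤s)
open import Data.Bool using (Bool; true; false; not)
open import Data.Bool.Properties using (not-involutive; not-injective)
open import Data.Vec using (Vec; _∷_)
open import Data.Product using (_,_; proj₁)
open import Data.Empty using (⊥-elim)
open import Function using (_∘_)
open import Function.Bundles using (mk⇔)
open import Relation.Nullary using (¬_)
open import Relation.Binary.PropositionalEquality
  using (_≡_; refl; cong; subst₂; module ≡-Reasoning)

involution⇒InducedEmbedding :
  ∀ {n} (σ : Vec Bool n → Vec Bool n) →
  (∀ x → σ (σ x) ≡ x) →
  (∀ {x y} → Adj x y → Adj (σ x) (σ y)) →
  (∀ x → Fib x → Has11 (σ x)) →
  InducedEmbedding n
involution⇒InducedEmbedding σ σ-involutive σ-adj σ-fib = record
  { f     = λ (x , x-fib) → σ x , σ-fib x x-fib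
  ; inj   = λ u v σu≡σv → σ-injective (proj₁ u) (proj₁ v) σu≡σv
  ; adj⇔  = λ u v → mk⇔ σ-adj (σ-adj-reflect (proj₁ u) (proj₁ v))
  }
  where
  σ-injective : ∀ x y → σ x ≡ σ y → x ≡ y
  σ-injective x y σx≡σy = begin
    x         ≡⟨ σ-involutive x ⟨
    σ (σ x)   ≡⟨ cong σ σx≡σy ⟩
    σ (σ y)   ≡⟨ σ-involutive y ⟩
    y         ∎
    where open ≡-Reasoning

  σ-adj-reflect : ∀ x y → Adj (σ x) (σ y) → Adj x y
  σ-adj-reflect x y = subst₂ Adj (σ-involutive x) (σ-involutive y) ∘ σ-adj

Vec≥4 : ℕ → Set
Vec≥4 m = Vec Bool (suc (suc (suc (suc m))))

σ : ∀ {m} → Vec≥4 m → Vec≥4 m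
σ (a ∷ b ∷ c ∷ d ∷ u) = not a ∷ not c ∷ not b ∷ not d ∷ u

σ-involutive : ∀ {m} (x : Vec≥4 m) → σ (σ x) ≡ x
σ-involutive (a ∷ b ∷ c ∷ d ∷ u)
  rewrite not-involutive a | not-involutive b
        | not-involutive c | not-involutive d = refl

not-preserves-≢ : ∀ {a b} → ¬ a ≡ b → ¬ not a ≡ not b
not-preserves-≢ a≢b = a≢b ∘ not-injective

σ-preserves-Adj : ∀ {m} {x y : Vec≥4 m} → Adj x y → Adj (σ x) (σ y)
σ-preserves-Adj {x = _ ∷ _ ∷ _ ∷ _ ∷ _} {_ ∷ _ ∷ _ ∷ _ ∷ _} adj with adj
... | here p                           = here (not-preserves-≢ p)
... | there (here p)                   = there (there (here (not-preserves-≢ p)))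
... | there (there (here p))           = there (here (not-preserves-≢ p))
... | there (there (there (here p)))   = there (there (there (here (not-preserves-≢ p))))
... | there (there (there (there p)))  = there (there (there (there p)))

σ-Fib⇒Has11 : ∀ {m} (x : Vec≥4 m) → Fib x → Has11 (σ x)
σ-Fib⇒Has11 (false ∷ _     ∷ false ∷ _     ∷ _) _   = here
σ-Fib⇒Has11 (true  ∷ false ∷ false ∷ _     ∷ _) _   = there here
σ-Fib⇒Has11 (true  ∷ true  ∷ false ∷ _     ∷ _) fib = ⊥-elim (fib here)
σ-Fib⇒Has11 (_     ∷ false ∷ true  ∷ false ∷ _) _   = there (there here)
σ-Fib⇒Has11 (_     ∷ true  ∷ true  ∷ _     ∷ _) fib = ⊥-elim (fib (there here))
σ-Fib⇒Has11 (_     ∷ _     ∷ true  ∷ true  ∷ _) fib = ⊥-elim (fib (there (there here)))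

mainTheorem17 : (n : ℕ) → n ≥ 4 → InducedEmbedding n
mainTheorem17 (suc (suc (suc (suc m)))) _ =
  involution⇒InducedEmbedding σ σ-involutive σ-preserves-Adj σ-Fib⇒Has11
mainTheorem17 0 ()
mainTheorem17 1 (s≤s ())
mainTheorem17 2 (s≤s (s≤s ()))
mainTheorem17 3 (s≤s (s≤s (s≤s ())))
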